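{- Let $\mathcal{H}$ be an $n$-quasicluster. If $\mathcal{H}$ is edge arithmetic and has different central edges, then $\chi(\mathcal{H})\le n$.
   Context: A hypergraph $\mathcal{H}=(\mathcal{V},\mathcal{E})$ has a finite nonempty vertex set $\mathcal{V}$ and a finite collection $\mathcal{E}$ of subsets of $\mathcal{V}$ (edges), each with at least two vertices, every vertex lying in some edge. It is linear if $|E\cap F|\le 1$ and intersecting if $|E\cap F|=1$ for all distinct $E,F\in\mathcal{E}$. An $n$-quasicluster is an intersecting linear hypergraph with exactly $n$ edges, each containing at most $n$ vertices, in which every vertex belongs to at least two edges. The chromatic number $\chi(\mathcal{H})$ is the least $k$ such that there is a map $\mathcal{V}\to\{1,\dots,k\}$ assigning distinct colors to any two distinct vertices lying in a common edge. A subset $W=\{w_1,\dots,w_r\}$ of $\mathbb{Z}_n$ is $k$-arithmetic, for some $k\in\{1,\dots,\lfloor n/2\rfloor\}$, if its elements can be listed as $w_1,\dots,w_r$ with $w_{i+1}-w_i\equiv k\pmod n$ for $i=1,\dots,r-1$. An $n$-quasicluster $\mathcal{H}$ is edge arithmetic if there is a bijection $\varphi:\mathcal{E}\to\mathbb{Z}_n$ such that for each vertex $u$, the set $F(u)=\{\varphi(E): u\in E\in\mathcal{E}\}$ is, for some $k\in\{1,\dots,\lfloor n/2\rfloor\}$, either $k$-arithmetic or can be partitioned into two $k$-arithmetic sets of the same cardinality. For a vertex $u$ of odd degree $l$, with $F(u)$ listed as $\varphi(E_1),\dots,\varphi(E_l)$ with consecutive differences $k$, the edge $E_{(l+1)/2}$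 is the central edge of $u$. $\mathcal{H}$ has different central edges if any two distinct vertices of odd degree have different central edges. -}

module Defs where

open import Data.Nat using (ℕ; _≤_; _/_; _%_; _≡ᵇ_)
open import Data.Fin using (Fin; toℕ)
open import Data.Fin.Subset using (Subset; _∈_; _∩_; ∣_∣)
open import Data.Fin.Subset.Properties using (_∈?_)
open import Data.Integer using (ℤ; +_; _-_)
open import Data.Integer.Divisibility using () renaming (_∣_ to _∣ℤ_)
open import Data.List using (List; []; _∷_; length; filter; allFin; drop; _++_)
open import Data.List.Relation.Unary.Unique.Propositional using (Unique)
open import Data.List.Membership.Propositional using () renaming (_∈_ to _∈ₗ_)
open import Data.Maybe using (Maybe; just; nothing)
open import Data.Product using (Σ; _×_; _,_; ∃; ∃-syntax)
open import Data.Sum using (_⊎_; inj₁; inj₂)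
open import Function.Bundles using (_⇔_; _↔_; Inverse)
open import Relation.Binary.PropositionalEquality using (_≡_; _≢_)
open import Relation.Nullary using (¬_)
open import Data.Unit using (⊤)
open import Data.Empty using (⊥)

record Hypergraph (m : ℕ) : Set where
  field
    V        : ℕ
    edge     : Fin m → Subset V
    nonempty : 1 ≤ V
    edge≥2   : ∀ i → 2 ≤ ∣ edge i ∣
    covered  : ∀ (u : Fin V) → ∃[ i ] (u ∈ edge i)
open Hypergraph public

degree : ∀ {m} (H : Hypergraph m) → Fin (V H) → ℕ
degree {m} H u = length (filter (λ i → u ∈? edge H i) (allFin m))

IsLinear : ∀ {m} → Hypergraph m → Set
IsLinear H = ∀ i j → i ≢ j → ∣ edge H i ∩ edge H j ∣ ≤ 1

IsIntersecting : ∀ {m} → Hypergraph m → Set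
IsIntersecting H = ∀ i j → i ≢ j → ∣ edge H i ∩ edge H j ∣ ≡ 1

IsQuasicluster : (n : ℕ) → Hypergraph n → Set
IsQuasicluster n H =
  IsIntersecting H × IsLinear H ×
  (∀ i → ∣ edge H i ∣ ≤ n) ×
  (∀ u → 2 ≤ degree H u)

-- Arithmetic sets in ℤ_n (ℤ_n is represented by Fin n).

StepBy : (n k : ℕ) → Fin n → Fin n → Set
StepBy n k a b = (+ n) ∣ℤ ((+ toℕ b - + toℕ a) - + k)

Consecutive : (n k : ℕ) → List (Fin n) → Set
Consecutive n k []           = ⊤
Consecutive n k (a ∷ [])     = ⊤
Consecutive n k (a ∷ b ∷ ws) = StepBy n k a b × Consecutive n k (b ∷ ws)

ArithListing : (n k : ℕ) → List (Fin n) → Set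
ArithListing n k ws = Unique ws × Consecutive n k ws

Lists : ∀ {n} → (Fin n → Set) → List (Fin n) → Set
Lists {n} W ws = ∀ (x : Fin n) → (W x ⇔ (x ∈ₗ ws))

KArithListing : (n k : ℕ) → (Fin n → Set) → Set
KArithListing n k W = Σ (List (Fin n)) λ ws → ArithListing n k ws × Lists W ws

KArithSplit : (n k : ℕ) → (Fin n → Set) → Set
KArithSplit n k W =
  Σ (List (Fin n)) λ ws₁ → Σ (List (Fin n)) λ ws₂ →
    ArithListing n k ws₁ × ArithListing n k ws₂ ×
    length ws₁ ≡ length ws₂ ×
    Unique (ws₁ ++ ws₂) ×
    Lists W (ws₁ ++ ws₂)

Fset : ∀ {n} (H : Hypergraph n) → (Fin n → Fin n) → Fin (V H) → Fin n → Set
Fset {n} H φ u x = ∃[ i ] (φ i ≡ x × u ∈ edge H i)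

VertexArith : ∀ {n} (H : Hypergraph n) → (Fin n → Fin n) → Fin (V H) → Set
VertexArith {n} H φ u =
  Σ ℕ λ k → (1 ≤ k) × (k ≤ n / 2) ×
    (KArithListing n k (Fset H φ u) ⊎ KArithSplit n k (Fset H φ u))

record EdgeArithmetic {n} (H : Hypergraph n) : Set where
  field
    φ   : Fin n ↔ Fin n
    wit : ∀ u → VertexArith H (Inverse.to φ) u
open EdgeArithmetic public

IsEdgeArithmetic : ∀ {n} → Hypergraph n → Set
IsEdgeArithmetic H = EdgeArithmetic H

-- middle element w_{(l+1)/2} of a listing of odd length l (0-based index ⌊l/2⌋)
middle : ∀ {A : Set} → List A → Maybe A
middle ws with drop (length ws / 2) ws
... | []    = nothing
... | x ∷ _ = just x

Odd : ℕ → Set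
Odd l = l % 2 ≡ 1

-- For odd degree the witness
-- is necessarily a single k-arithmetic listing (a split has even size).
centralEdge : ∀ {n} {H : Hypergraph n} (A : EdgeArithmetic H) → Fin (V H) → Maybe (Fin n)
centralEdge {n} {H} A u with wit A u
... | (k , _ , _ , inj₂ _) = nothing
... | (k , _ , _ , inj₁ (ws , _ , _)) with middle ws
...   | nothing = nothing
...   | just w  = just (Inverse.from (φ A) w)

DifferentCentralEdges : ∀ {n} {H : Hypergraph n} → EdgeArithmetic H → Set
DifferentCentralEdges {n} {H} A =
  ∀ (u v : Fin (V H)) → u ≢ v → Odd (degree H u) → Odd (degree H v) →
    ∀ (e : Fin n) → centralEdge A u ≡ just e → centralEdge A v ≡ just e → ⊥

ProperColouring : ∀ {m} (H : Hypergraph m) (c : ℕ) → (Fin (V H) → Fin c) → Set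
ProperColouring {m} H c col =
  ∀ (i : Fin m) (x y : Fin (V H)) → x ∈ edge H i → y ∈ edge H i → x ≢ y → col x ≢ col y

χ≤ : ∀ {m} (H : Hypergraph m) (c : ℕ) → Set
χ≤ H c = Σ (Fin (V H) → Fin c) (ProperColouring H c)

-- Each F(u) is symmetric under a reflection x ↦ s(u) − x of ℤ_n: for a k-arithmetic listing
-- w₁,…,w_l take s(u) = 2w₁ + (l−1)k, which pairs w_i with w_{l+1−i}; for a split into listings
-- w₁,…,w_m and w′₁,…,w′_m take s(u) = w₁ + w′₁ + (m−1)k, which pairs w_i with w′_{m+1−i}.
-- Colour u by s(u) mod n.  If two vertices u ≠ v of an edge E get the same colour, the
-- reflections of φ(E) in F(u) and in F(v) coincide, so u and v share the edge φ⁻¹(s − φ(E)),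
-- which by linearity is E itself.  Thus φ(E) is a fixed point of the reflection: a split has
-- none (the reflection swaps its two disjoint halves), and in a listing it is the middle
-- element of an odd-length listing.  So u and v both have odd degree and central edge E.
module Submission where

open import Defs
open import Data.Empty using (⊥; ⊥-elim)
open import Data.Fin as Fin using (Fin; toℕ)
import Data.Fin.Properties as Fin
open import Data.Fin.Subset using (Subset; _∈_; _⊆_; _∩_; ∣_∣; ⁅_⁆)
open import Data.Fin.Subset.Properties using (_∈?_; x∈p∩q⁺; ∣⁅x⁆∣≡1; x∈⁅y⁆⇒x≡y; p⊂q⇒∣p∣<∣q∣)
open import Data.Integer as ℤ using (+_)
import Data.Integer.Properties as ℤ
open import Data.Integer.Divisibility.Signed using (_∣_; divides; ∣ᵤ⇒∣; ∣⇒∣ᵤ; ∣m∣n⇒∣m+n; ∣m⇒∣-m)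
open import Data.Integer.Tactic.RingSolver using (solve-∀)
open import Data.List using (List; []; _∷_; length; lookup; drop; _++_; map; filter; allFin)
import Data.List.Properties as List
open import Data.List.Membership.Propositional using () renaming (_∈_ to _∈ₗ_)
open import Data.List.Membership.Propositional.Properties
  using (∈-lookup; ∈-++⁺ˡ; ∈-++⁺ʳ; ∈-++⁻; ∈-map⁺; ∈-map⁻; ∈-filter⁺; ∈-filter⁻; ∈-allFin)
open import Data.List.Relation.Binary.Subset.Propositional using () renaming (_⊆_ to _⊆ₗ_)
open import Data.List.Relation.Unary.All as All using ()
open import Data.List.Relation.Unary.Any using (here; there; index)
open import Data.List.Relation.Unary.Any.Properties using (lookup-index)
open import Data.List.Relation.Unary.Unique.Propositional using (Unique; _∷_)
import Data.List.Relation.Unary.Unique.Propositional.Properties as Unique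
open import Data.Maybe using (Maybe; just; nothing)
open import Data.Maybe.Properties using (just-injective)
open import Data.Nat as ℕ using (ℕ; zero; suc; _+_; _*_; _/_; _%_; _≤_; _<_; NonZero; s≤s; z≤n)
open import Data.Nat.DivMod using (_mod_; m≡m%n+[m/n]*n; m<n⇒m%n≡m; m/n≡1+[m∸n]/n)
open import Data.Nat.Divisibility using (n∣m⇒m%n≡0)
import Data.Nat.Properties as ℕ
import Data.Nat.Tactic.RingSolver as ℕ-Solver
open import Data.Product using (Σ; _×_; _,_; proj₁; proj₂; ∃-syntax)
open import Data.Sum using (_⊎_; inj₁; inj₂)
open import Function using (_$_; _∘_)
open import Function.Bundles using (Equivalence; Inverse)
open import Function.Definitions using (Injective)
open import Level using (0ℓ)
open import Relation.Binary.Bundles using (Setoid)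
open import Relation.Binary.Structures using (IsEquivalence)
open import Relation.Binary.PropositionalEquality
open import Relation.Nullary using (¬_; Dec; yes; no)

open Equivalence using (to; from)

private variable
  A : Set
  n : ℕ

infix 4 _≡_[mod_]

record _≡_[mod_] (a b n : ℕ) : Set where
  constructor mk≡[mod]
  field
    divides-difference : + n ∣ + a ℤ.- + b

module _ {n : ℕ} where

  ≡[mod]-reflexive : ∀ {a b} → a ≡ b → a ≡ b [mod n ]
  ≡[mod]-reflexive {a} refl =
    mk≡[mod] $ divides (+ 0) (trans (ℤ.+-inverseʳ (+ a)) (sym (ℤ.*-zeroˡ (+ n))))

  ≡[mod]-sym : ∀ {a b} → a ≡ b [mod n ] → b ≡ a [mod n ]
  ≡[mod]-sym {a} {b} (mk≡[mod] n∣a-b) =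
    mk≡[mod] $ subst (+ n ∣_) (negate (+ a) (+ b)) (∣m⇒∣-m n∣a-b)
    where
    negate : ∀ x y → ℤ.- (x ℤ.- y) ≡ y ℤ.- x
    negate = solve-∀

  ≡[mod]-trans : ∀ {a b c} → a ≡ b [mod n ] → b ≡ c [mod n ] → a ≡ c [mod n ]
  ≡[mod]-trans {a} {b} {c} (mk≡[mod] n∣a-b) (mk≡[mod] n∣b-c) =
    mk≡[mod] $ subst (+ n ∣_) (telescope (+ a) (+ b) (+ c)) (∣m∣n⇒∣m+n n∣a-b n∣b-c)
    where
    telescope : ∀ x y z → (x ℤ.- y) ℤ.+ (y ℤ.- z) ≡ x ℤ.- z
    telescope = solve-∀

  ≡[mod]-isEquivalence : IsEquivalence _≡_[mod n ]
  ≡[mod]-isEquivalence = record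
    { refl = ≡[mod]-reflexive refl ; sym = ≡[mod]-sym ; trans = ≡[mod]-trans }

  +-cong-≡[mod] : ∀ {a b c d} → a ≡ b [mod n ] → c ≡ d [mod n ] → a + c ≡ b + d [mod n ]
  +-cong-≡[mod] {a} {b} {c} {d} (mk≡[mod] n∣a-b) (mk≡[mod] n∣c-d) =
    mk≡[mod] $ subst (+ n ∣_) (sym difference) (∣m∣n⇒∣m+n n∣a-b n∣c-d)
    where
    regroup : ∀ w x y z → (w ℤ.+ y) ℤ.- (x ℤ.+ z) ≡ (w ℤ.- x) ℤ.+ (y ℤ.- z)
    regroup = solve-∀
    difference : + (a + c) ℤ.- + (b + d) ≡ (+ a ℤ.- + b) ℤ.+ (+ c ℤ.- + d)
    difference = trans (cong₂ ℤ._-_ (ℤ.pos-+ a c) (ℤ.pos-+ b d)) (regroup (+ a) (+ b) (+ c) (+ d))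

  +-cancelˡ-≡[mod] : ∀ a {b c} → a + b ≡ a + c [mod n ] → b ≡ c [mod n ]
  +-cancelˡ-≡[mod] a {b} {c} (mk≡[mod] n∣a+b-a+c) =
    mk≡[mod] $ subst (+ n ∣_) difference n∣a+b-a+c
    where
    cancel : ∀ x y z → (x ℤ.+ y) ℤ.- (x ℤ.+ z) ≡ y ℤ.- z
    cancel = solve-∀
    difference : + (a + b) ℤ.- + (a + c) ≡ + b ℤ.- + c
    difference = trans (cong₂ ℤ._-_ (ℤ.pos-+ a b) (ℤ.pos-+ a c)) (cancel (+ a) (+ b) (+ c))

  m+q*n≡[mod]m : ∀ m q → m + q * n ≡ m [mod n ]
  m+q*n≡[mod]m m q = mk≡[mod] $ divides (+ q) (begin
    + (m + q * n) ℤ.- + m          ≡⟨ cong (ℤ._- + m) (ℤ.pos-+ m (q * n)) ⟩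
    (+ m ℤ.+ + (q * n)) ℤ.- + m    ≡⟨ cancel (+ m) (+ (q * n)) ⟩
    + (q * n)                      ≡⟨ ℤ.pos-* q n ⟩
    + q ℤ.* + n                    ∎)
    where
    open ≡-Reasoning
    cancel : ∀ x y → (x ℤ.+ y) ℤ.- x ≡ y
    cancel = solve-∀

≡[mod]-setoid : ℕ → Setoid 0ℓ 0ℓ
≡[mod]-setoid n = record { isEquivalence = ≡[mod]-isEquivalence {n} }

module ≡[mod]-Reasoning (n : ℕ) where
  open import Relation.Binary.Reasoning.Setoid (≡[mod]-setoid n) public

mod-≡⇒≡[mod] : ∀ {a b} .{{_ : NonZero n}} → a mod n ≡ b mod n → a ≡ b [mod n ]
mod-≡⇒≡[mod] {n} {a} {b} a-mod-n≡b-mod-n = begin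
  a                  ≡⟨ m≡m%n+[m/n]*n a n ⟩
  a % n + a / n * n  ≈⟨ m+q*n≡[mod]m (a % n) (a / n) ⟩
  a % n              ≡⟨ a%n≡b%n ⟩
  b % n              ≈⟨ m+q*n≡[mod]m (b % n) (b / n) ⟨
  b % n + b / n * n  ≡⟨ m≡m%n+[m/n]*n b n ⟨
  b                  ∎
  where
  open ≡[mod]-Reasoning n
  a%n≡b%n : a % n ≡ b % n
  a%n≡b%n = trans (sym (Fin.toℕ-fromℕ< _)) (trans (cong toℕ a-mod-n≡b-mod-n) (Fin.toℕ-fromℕ< _))

stepBy⇒≡[mod] : ∀ {k} {a b : Fin n} → StepBy n k a b → toℕ b ≡ toℕ a + k [mod n ]
stepBy⇒≡[mod] {n} {k} {a} {b} step = mk≡[mod] $ subst (+ n ∣_) difference (∣ᵤ⇒∣ step)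
  where
  reassoc : ∀ x y z → (x ℤ.- y) ℤ.- z ≡ x ℤ.- (y ℤ.+ z)
  reassoc = solve-∀
  difference : (+ toℕ b ℤ.- + toℕ a) ℤ.- + k ≡ + toℕ b ℤ.- + (toℕ a + k)
  difference = trans (reassoc (+ toℕ b) (+ toℕ a) (+ k)) (cong (λ z → + toℕ b ℤ.- z) (sym (ℤ.pos-+ (toℕ a) k)))

toℕ-≡[mod]⇒≡ : ∀ {x y : Fin n} → toℕ x ≡ toℕ y [mod n ] → x ≡ y
toℕ-≡[mod]⇒≡ {n} {x} {y} (mk≡[mod] n∣x-y) =
  Fin.toℕ-injective (ℤ.+-injective (ℤ.i-j≡0⇒i≡j _ _ (ℤ.∣i∣≡0⇒i≡0 distance≡0)))
  where
  instance
    _ = Fin.nonZeroIndex x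
  distance : ℕ
  distance = ℤ.∣ + toℕ x ℤ.- + toℕ y ∣
  distance<n : distance < n
  distance<n = ℕ.≤-<-trans
    (subst (_≤ toℕ x ℕ.⊔ toℕ y) (cong ℤ.∣_∣ (sym (ℤ.[+m]-[+n]≡m⊖n (toℕ x) (toℕ y))))
      (ℤ.∣m⊝n∣≤m⊔n (toℕ x) (toℕ y)))
    (ℕ.⊔-lub (Fin.toℕ<n x) (Fin.toℕ<n y))
  distance≡0 : distance ≡ 0
  distance≡0 = trans (sym (m<n⇒m%n≡m distance<n)) (n∣m⇒m%n≡0 distance n (∣⇒∣ᵤ n∣x-y))

partner-unique : ∀ {s} {x y z : Fin n} →
                 toℕ x + toℕ y ≡ s [mod n ] → toℕ x + toℕ z ≡ s [mod n ] → y ≡ z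
partner-unique {x = x} x+y≡s x+z≡s =
  toℕ-≡[mod]⇒≡ (+-cancelˡ-≡[mod] (toℕ x) (≡[mod]-trans x+y≡s (≡[mod]-sym x+z≡s)))

lookup-injective : ∀ {xs : List A} → Unique xs → Injective _≡_ _≡_ (lookup xs)
lookup-injective {xs = _ ∷ _} (_ ∷ _) {Fin.zero} {Fin.zero} _ = refl
lookup-injective {xs = _ ∷ _} (x∉xs ∷ _) {Fin.zero} {Fin.suc j} eq =
  ⊥-elim (All.lookup x∉xs (∈-lookup j) eq)
lookup-injective {xs = _ ∷ _} (x∉xs ∷ _) {Fin.suc i} {Fin.zero} eq =
  ⊥-elim (All.lookup x∉xs (∈-lookup i) (sym eq))
lookup-injective {xs = _ ∷ _} (_ ∷ xs!) {Fin.suc i} {Fin.suc j} eq =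
  cong Fin.suc (lookup-injective xs! eq)

++-disjoint : ∀ {x : A} xs {ys} → Unique (xs ++ ys) → x ∈ₗ xs → x ∈ₗ ys → ⊥
++-disjoint (_ ∷ xs) (x∉ ∷ _) (here refl) x∈ys = All.lookup x∉ (∈-++⁺ʳ xs x∈ys) refl
++-disjoint (_ ∷ xs) (_ ∷ u) (there x∈xs) x∈ys = ++-disjoint xs u x∈xs x∈ys

Unique-⊆⇒length-≤ : ∀ {xs ys : List A} → Unique xs → xs ⊆ₗ ys → length xs ≤ length ys
Unique-⊆⇒length-≤ {xs = xs} {ys} xs! xs⊆ys = Fin.injective⇒≤ position-injective
  where
  position : Fin (length xs) → Fin (length ys)
  position i = index (xs⊆ys (∈-lookup i))
  position-injective : Injective _≡_ _≡_ position
  position-injective {i} {j} eq = lookup-injective xs! (begin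
    lookup xs i             ≡⟨ lookup-index (xs⊆ys (∈-lookup i)) ⟩
    lookup ys (position i)  ≡⟨ cong (lookup ys) eq ⟩
    lookup ys (position j)  ≡⟨ lookup-index (xs⊆ys (∈-lookup j)) ⟨
    lookup xs j             ∎)
    where open ≡-Reasoning

drop-lookup : ∀ (xs : List A) i → drop (toℕ i) xs ≡ lookup xs i ∷ drop (suc (toℕ i)) xs
drop-lookup (_ ∷ _) Fin.zero = refl
drop-lookup (_ ∷ xs) (Fin.suc i) = drop-lookup xs i

middle≡just : ∀ (xs : List A) {y ys} → drop (length xs / 2) xs ≡ y ∷ ys → middle xs ≡ just y
middle≡just xs eq with drop (length xs / 2) xs | eq
... | _ | refl = refl

suc-double-%2 : ∀ m → suc (m + m) % 2 ≡ 1
suc-double-%2 zero = refl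
suc-double-%2 (suc m) rewrite ℕ.+-suc m m = suc-double-%2 m

suc-double-/2 : ∀ m → suc (m + m) / 2 ≡ m
suc-double-/2 zero = refl
suc-double-/2 (suc m) rewrite ℕ.+-suc m m =
  trans (m/n≡1+[m∸n]/n {suc (suc (suc (m + m)))} (s≤s (s≤s z≤n))) (cong suc (suc-double-/2 m))

middle-lookup : ∀ (xs : List A) i → length xs ≡ suc (toℕ i + toℕ i) →
                Odd (length xs) × middle xs ≡ just (lookup xs i)
middle-lookup xs i len≡ =
  subst Odd (sym len≡) (suc-double-%2 (toℕ i)) ,
  middle≡just xs (begin
    drop (length xs / 2) xs                  ≡⟨ cong (λ m → drop (m / 2) xs) len≡ ⟩
    drop (suc (toℕ i + toℕ i) / 2) xs        ≡⟨ cong (λ m → drop m xs) (suc-double-/2 (toℕ i)) ⟩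
    drop (toℕ i) xs                          ≡⟨ drop-lookup xs i ⟩
    lookup xs i ∷ drop (suc (toℕ i)) xs      ∎)
  where open ≡-Reasoning

complement : ∀ {l m} → l ≡ m → (i : Fin (suc l)) → Σ (Fin (suc m)) λ j → toℕ i + toℕ j ≡ l
complement refl i =
  Fin.opposite i , trans (cong (_+_ (toℕ i)) (Fin.opposite-prop i)) (ℕ.m+[n∸m]≡n (Fin.toℕ≤pred[n] i))

module _ {n k : ℕ} where

  private variable
    a b x : Fin n
    r r₁ r₂ : List (Fin n)

  pairSum : Fin n → Fin n → List (Fin n) → ℕ
  pairSum a b r = toℕ a + toℕ b + length r * k

  pairSum-comm : ∀ a b (r₁ r₂ : List (Fin n)) → length r₁ ≡ length r₂ → pairSum b a r₂ ≡ pairSum a b r₁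
  pairSum-comm a b _ _ l₁≡l₂ = cong₂ (λ s m → s + m * k) (ℕ.+-comm (toℕ b) (toℕ a)) (sym l₁≡l₂)

  lookup-consecutive : Consecutive n k (a ∷ r) → ∀ i →
                       toℕ (lookup (a ∷ r) i) ≡ toℕ a + toℕ i * k [mod n ]
  lookup-consecutive _ Fin.zero = ≡[mod]-reflexive (sym (ℕ.+-identityʳ _))
  lookup-consecutive {a} {b ∷ r} (a↝b , b∷r-consecutive) (Fin.suc i) = begin
    toℕ (lookup (b ∷ r) i)       ≈⟨ lookup-consecutive b∷r-consecutive i ⟩
    toℕ b + toℕ i * k            ≈⟨ +-cong-≡[mod] (stepBy⇒≡[mod] {a = a} {b = b} a↝b) (≡[mod]-reflexive refl) ⟩
    toℕ a + k + toℕ i * k        ≡⟨ ℕ.+-assoc (toℕ a) k (toℕ i * k) ⟩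
    toℕ a + toℕ (Fin.suc i) * k  ∎
    where open ≡[mod]-Reasoning n

  ∈-pairSum : Consecutive n k (a ∷ r₁) → Consecutive n k (b ∷ r₂) → (x∈ : x ∈ₗ a ∷ r₁) →
              ∀ j → toℕ (index x∈) + toℕ j ≡ length r₁ →
              toℕ x + toℕ (lookup (b ∷ r₂) j) ≡ pairSum a b r₁ [mod n ]
  ∈-pairSum {a} {r₁} {b} {r₂} {x} c₁ c₂ x∈ j i+j≡l = begin
    toℕ x + toℕ (lookup (b ∷ r₂) j)
      ≡⟨ cong (λ z → toℕ z + toℕ (lookup (b ∷ r₂) j)) (lookup-index x∈) ⟩
    toℕ (lookup (a ∷ r₁) i) + toℕ (lookup (b ∷ r₂) j)
      ≈⟨ +-cong-≡[mod] (lookup-consecutive c₁ i) (lookup-consecutive c₂ j) ⟩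
    (toℕ a + toℕ i * k) + (toℕ b + toℕ j * k)
      ≡⟨ regroup (toℕ a) (toℕ b) (toℕ i) (toℕ j) k ⟩
    toℕ a + toℕ b + (toℕ i + toℕ j) * k
      ≡⟨ cong (λ m → toℕ a + toℕ b + m * k) i+j≡l ⟩
    pairSum a b r₁
      ∎
    where
    open ≡[mod]-Reasoning n
    i : Fin (suc (length r₁))
    i = index x∈
    regroup : ∀ a b i j k → (a + i * k) + (b + j * k) ≡ a + b + (i + j) * k
    regroup = ℕ-Solver.solve-∀

  consecutive-partner : Consecutive n k (a ∷ r₁) → Consecutive n k (b ∷ r₂) → length r₁ ≡ length r₂ →
                        x ∈ₗ a ∷ r₁ → ∃[ y ] y ∈ₗ b ∷ r₂ × toℕ x + toℕ y ≡ pairSum a b r₁ [mod n ]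
  consecutive-partner {b = b} {r₂} c₁ c₂ l₁≡l₂ x∈ =
    let j , i+j≡l = complement l₁≡l₂ (index x∈)
    in lookup (b ∷ r₂) j , ∈-lookup j , ∈-pairSum c₁ c₂ x∈ j i+j≡l

  consecutive-partner-swap : Consecutive n k (a ∷ r₁) → Consecutive n k (b ∷ r₂) → length r₁ ≡ length r₂ →
                             x ∈ₗ b ∷ r₂ → ∃[ y ] y ∈ₗ a ∷ r₁ × toℕ x + toℕ y ≡ pairSum a b r₁ [mod n ]
  consecutive-partner-swap {a} {r₁} {b} {r₂} {x} c₁ c₂ l₁≡l₂ x∈ =
    let y , y∈ , x+y≡s = consecutive-partner c₂ c₁ (sym l₁≡l₂) x∈
    in y , y∈ , subst (λ s → toℕ x + toℕ y ≡ s [mod n ]) (pairSum-comm a b r₁ r₂ l₁≡l₂) x+y≡s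

  consecutive-fixed : Unique (a ∷ r) → Consecutive n k (a ∷ r) → x ∈ₗ a ∷ r →
                      toℕ x + toℕ x ≡ pairSum a a r [mod n ] →
                      Odd (length (a ∷ r)) × middle (a ∷ r) ≡ just x
  consecutive-fixed {a} {r} {x} a∷r! c x∈ 2x≡s =
    subst (λ z → Odd (length (a ∷ r)) × middle (a ∷ r) ≡ just z) (sym x≡xᵢ)
      (middle-lookup (a ∷ r) i (cong suc (trans (sym i+j≡l) i+j≡i+i)))
    where
    i : Fin (length (a ∷ r))
    i = index x∈
    x≡xᵢ : x ≡ lookup (a ∷ r) i
    x≡xᵢ = lookup-index x∈
    j : Fin (length (a ∷ r))
    j = proj₁ (complement refl i)
    i+j≡l : toℕ i + toℕ j ≡ length r
    i+j≡l = proj₂ (complement refl i)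
    xⱼ≡x : lookup (a ∷ r) j ≡ x
    xⱼ≡x = partner-unique (∈-pairSum c c x∈ j i+j≡l) 2x≡s
    i+j≡i+i : toℕ i + toℕ j ≡ toℕ i + toℕ i
    i+j≡i+i = cong (λ z → toℕ i + toℕ z) (lookup-injective a∷r! (trans xⱼ≡x x≡xᵢ))

  split-partner : Consecutive n k (a ∷ r₁) → Consecutive n k (b ∷ r₂) → length r₁ ≡ length r₂ →
                  x ∈ₗ (a ∷ r₁) ++ (b ∷ r₂) →
                  ∃[ y ] y ∈ₗ (a ∷ r₁) ++ (b ∷ r₂) × toℕ x + toℕ y ≡ pairSum a b r₁ [mod n ]
  split-partner {a} {r₁} c₁ c₂ l₁≡l₂ x∈ with ∈-++⁻ (a ∷ r₁) x∈
  ... | inj₁ x∈₁ = let y , y∈₂ , x+y≡s = consecutive-partner c₁ c₂ l₁≡l₂ x∈₁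
                   in y , ∈-++⁺ʳ (a ∷ r₁) y∈₂ , x+y≡s
  ... | inj₂ x∈₂ = let y , y∈₁ , x+y≡s = consecutive-partner-swap c₁ c₂ l₁≡l₂ x∈₂
                   in y , ∈-++⁺ˡ y∈₁ , x+y≡s

  split-fixed-free : Unique ((a ∷ r₁) ++ (b ∷ r₂)) → Consecutive n k (a ∷ r₁) → Consecutive n k (b ∷ r₂) →
                     length r₁ ≡ length r₂ → x ∈ₗ (a ∷ r₁) ++ (b ∷ r₂) →
                     ¬ (toℕ x + toℕ x ≡ pairSum a b r₁ [mod n ])
  split-fixed-free {a} {r₁} {b} {r₂} ws! c₁ c₂ l₁≡l₂ x∈ 2x≡s with ∈-++⁻ (a ∷ r₁) x∈
  ... | inj₁ x∈₁ = let _ , y∈₂ , x+y≡s = consecutive-partner c₁ c₂ l₁≡l₂ x∈₁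
                   in ++-disjoint (a ∷ r₁) ws! x∈₁ (subst (_∈ₗ b ∷ r₂) (partner-unique x+y≡s 2x≡s) y∈₂)
  ... | inj₂ x∈₂ = let _ , y∈₁ , x+y≡s = consecutive-partner-swap c₁ c₂ l₁≡l₂ x∈₂
                   in ++-disjoint (a ∷ r₁) ws! (subst (_∈ₗ a ∷ r₁) (partner-unique x+y≡s 2x≡s) y∈₁) x∈₂

ArithmeticSet : (n : ℕ) → (Fin n → Set) → Set
ArithmeticSet n W = Σ ℕ λ k → (1 ≤ k) × (k ≤ n / 2) × (KArithListing n k W ⊎ KArithSplit n k W)

module _ {n : ℕ} {W : Fin n → Set} where

  -- The value 0 in the last clause is junk: W is empty in every remaining case.
  reflectionSum : ArithmeticSet n W → ℕ
  reflectionSum (k , _ , _ , inj₁ (a ∷ r , _))          = pairSum {k = k} a a r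
  reflectionSum (k , _ , _ , inj₂ (a ∷ r₁ , b ∷ _ , _)) = pairSum {k = k} a b r₁
  reflectionSum _                                        = 0

  centre : ArithmeticSet n W → Maybe (Fin n)
  centre (_ , _ , _ , inj₁ (ws , _)) = middle ws
  centre (_ , _ , _ , inj₂ _)        = nothing

  arithmetic-partner : ∀ (S : ArithmeticSet n W) {x} → W x →
                       ∃[ y ] W y × toℕ x + toℕ y ≡ reflectionSum S [mod n ]
  arithmetic-partner (_ , _ , _ , inj₁ ([] , _ , lists)) {x} Wx with () ← to (lists x) Wx
  arithmetic-partner (_ , _ , _ , inj₁ (a ∷ r , (_ , c) , lists)) {x} Wx =
    let y , y∈ , x+y≡s = consecutive-partner c c refl (to (lists x) Wx)
    in y , from (lists y) y∈ , x+y≡s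
  arithmetic-partner (_ , _ , _ , inj₂ ([] , [] , _ , _ , _ , _ , lists)) {x} Wx with () ← to (lists x) Wx
  arithmetic-partner (_ , _ , _ , inj₂ (a ∷ r₁ , b ∷ r₂ , (_ , c₁) , (_ , c₂) , l≡ , _ , lists)) {x} Wx =
    let y , y∈ , x+y≡s = split-partner c₁ c₂ (ℕ.suc-injective l≡) (to (lists x) Wx)
    in y , from (lists y) y∈ , x+y≡s

  arithmetic-fixed : ∀ (S : ArithmeticSet n W) {x} → W x → toℕ x + toℕ x ≡ reflectionSum S [mod n ] →
                     centre S ≡ just x × ∃[ ws ] Unique ws × Lists W ws × Odd (length ws)
  arithmetic-fixed (_ , _ , _ , inj₁ ([] , _ , lists)) {x} Wx with () ← to (lists x) Wx
  arithmetic-fixed (_ , _ , _ , inj₁ (a ∷ r , (a∷r! , c) , lists)) {x} Wx 2x≡s =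
    let odd , middle≡x = consecutive-fixed a∷r! c (to (lists x) Wx) 2x≡s
    in middle≡x , a ∷ r , a∷r! , lists , odd
  arithmetic-fixed (_ , _ , _ , inj₂ ([] , [] , _ , _ , _ , _ , lists)) {x} Wx with () ← to (lists x) Wx
  arithmetic-fixed (_ , _ , _ , inj₂ (a ∷ r₁ , b ∷ r₂ , (_ , c₁) , (_ , c₂) , l≡ , ws! , lists)) {x} Wx 2x≡s =
    ⊥-elim (split-fixed-free ws! c₁ c₂ (ℕ.suc-injective l≡) (to (lists x) Wx) 2x≡s)

distinct-∈⇒1<∣p∣ : ∀ {p : Subset n} {x y} → x ∈ p → y ∈ p → x ≢ y → 1 < ∣ p ∣
distinct-∈⇒1<∣p∣ {p = p} {x} x∈p y∈p x≢y =
  subst (_< ∣ p ∣) (∣⁅x⁆∣≡1 x) (p⊂q⇒∣p∣<∣q∣ (⁅x⁆⊆p , _ , y∈p , y∉⁅x⁆))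
  where
  ⁅x⁆⊆p : ⁅ x ⁆ ⊆ p
  ⁅x⁆⊆p z∈⁅x⁆ = subst (_∈ p) (sym (x∈⁅y⁆⇒x≡y x z∈⁅x⁆)) x∈p
  y∉⁅x⁆ : ¬ (_ ∈ ⁅ x ⁆)
  y∉⁅x⁆ y∈⁅x⁆ = x≢y (sym (x∈⁅y⁆⇒x≡y x y∈⁅x⁆))

module _ {n} (H : Hypergraph n) where

  linear⇒edge-unique : IsLinear H → ∀ {u v i j} → u ≢ v → u ∈ edge H i → v ∈ edge H i →
                       u ∈ edge H j → v ∈ edge H j → i ≡ j
  linear⇒edge-unique linear {u} {v} {i} {j} u≢v u∈i v∈i u∈j v∈j with i Fin.≟ j
  ... | yes i≡j = i≡j
  ... | no i≢j  = ⊥-elim (ℕ.<⇒≱ 1<∣i∩j∣ (linear i j i≢j))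
    where
    1<∣i∩j∣ : 1 < ∣ edge H i ∩ edge H j ∣
    1<∣i∩j∣ = distinct-∈⇒1<∣p∣ (x∈p∩q⁺ (u∈i , u∈j)) (x∈p∩q⁺ (v∈i , v∈j)) u≢v

  degree≡length : ∀ {φ} → Injective _≡_ _≡_ φ → ∀ {u ws} → Unique ws → Lists (Fset H φ u) ws →
                  degree H u ≡ length ws
  degree≡length {φ} φ-injective {u} {ws} ws! lists = begin
    degree H u            ≡⟨ List.length-map φ edges ⟨
    length (map φ edges)  ≡⟨ ℕ.≤-antisym (Unique-⊆⇒length-≤ φ[edges]! (λ y∈ → to (lists _) (image⁻ y∈)))
                                         (Unique-⊆⇒length-≤ ws! (λ y∈ → image⁺ (from (lists _) y∈))) ⟩
    length ws             ∎
    where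
    open ≡-Reasoning
    u∈? : ∀ i → Dec (u ∈ edge H i)
    u∈? i = u ∈? edge H i
    edges : List (Fin n)
    edges = filter u∈? (allFin n)
    φ[edges]! : Unique (map φ edges)
    φ[edges]! = Unique.map⁺ φ-injective (Unique.filter⁺ u∈? (Unique.allFin⁺ n))
    image⁻ : ∀ {y} → y ∈ₗ map φ edges → Fset H φ u y
    image⁻ y∈ with i , i∈ , refl ← ∈-map⁻ φ y∈ = i , refl , proj₂ (∈-filter⁻ u∈? {xs = allFin n} i∈)
    image⁺ : ∀ {y} → Fset H φ u y → y ∈ₗ map φ edges
    image⁺ (i , refl , u∈i) = ∈-map⁺ φ (∈-filter⁺ u∈? (∈-allFin i) u∈i)

  centralEdge-≡ : ∀ (A : EdgeArithmetic H) u {x} → centre (wit A u) ≡ just x →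
                  centralEdge A u ≡ just (Inverse.from (φ A) x)
  centralEdge-≡ A u centre≡ with wit A u
  ... | _ , _ , _ , inj₁ (ws , _) with middle ws
  ...   | just _ = cong (just ∘ Inverse.from (φ A)) (just-injective centre≡)

module _ {n} (H : Hypergraph n) .{{_ : NonZero n}} (linear : IsLinear H)
         (A : EdgeArithmetic H) (distinct : DifferentCentralEdges A) where

  private
    φᴬ : Fin n → Fin n
    φᴬ = Inverse.to (φ A)

    φᴬ-injective : Injective _≡_ _≡_ φᴬ
    φᴬ-injective {i} {j} φi≡φj = begin
      i                          ≡⟨ Inverse.strictlyInverseʳ (φ A) i ⟨
      Inverse.from (φ A) (φᴬ i)  ≡⟨ cong (Inverse.from (φ A)) φi≡φj ⟩
      Inverse.from (φ A) (φᴬ j)  ≡⟨ Inverse.strictlyInverseʳ (φ A) j ⟩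
      j                          ∎
      where open ≡-Reasoning

    s : Fin (V H) → ℕ
    s u = reflectionSum (wit A u)

  fixed⇒odd-central : ∀ {u x} → Fset H φᴬ u x → toℕ x + toℕ x ≡ s u [mod n ] →
                      Odd (degree H u) × centralEdge A u ≡ just (Inverse.from (φ A) x)
  fixed⇒odd-central {u} Fux 2x≡s =
    let centre≡x , ws , ws! , lists , odd = arithmetic-fixed (wit A u) Fux 2x≡s
    in subst Odd (sym (degree≡length H φᴬ-injective ws! lists)) odd , centralEdge-≡ H A u centre≡x

  shared-edge-fixed : ∀ {i u v} → u ∈ edge H i → v ∈ edge H i → u ≢ v → s u ≡ s v [mod n ] →
                      toℕ (φᴬ i) + toℕ (φᴬ i) ≡ s u [mod n ]
  shared-edge-fixed {i} {u} {v} u∈i v∈i u≢v sᵤ≡sᵥ =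
    let yᵤ , (j , φj≡yᵤ , u∈j) , x+yᵤ≡sᵤ = arithmetic-partner (wit A u) (i , refl , u∈i)
        yᵥ , (j′ , φj′≡yᵥ , v∈j′) , x+yᵥ≡sᵥ = arithmetic-partner (wit A v) (i , refl , v∈i)
        yᵤ≡yᵥ = partner-unique x+yᵤ≡sᵤ (≡[mod]-trans x+yᵥ≡sᵥ (≡[mod]-sym sᵤ≡sᵥ))
        j′≡j = φᴬ-injective (trans φj′≡yᵥ (trans (sym yᵤ≡yᵥ) (sym φj≡yᵤ)))
        i≡j = linear⇒edge-unique H linear u≢v u∈i v∈i u∈j (subst (λ e → v ∈ edge H e) j′≡j v∈j′)
    in subst (λ y → toℕ (φᴬ i) + toℕ y ≡ s u [mod n ]) (trans (sym φj≡yᵤ) (cong φᴬ (sym i≡j))) x+yᵤ≡sᵤ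

  reflectionColouring : Fin (V H) → Fin n
  reflectionColouring u = s u mod n

  reflectionColouring-proper : ProperColouring H n reflectionColouring
  reflectionColouring-proper i u v u∈i v∈i u≢v same-colour =
    let oddᵤ , centralᵤ = fixed⇒odd-central (i , refl , u∈i) 2x≡sᵤ
        oddᵥ , centralᵥ = fixed⇒odd-central (i , refl , v∈i) (≡[mod]-trans 2x≡sᵤ sᵤ≡sᵥ)
    in distinct u v u≢v oddᵤ oddᵥ (Inverse.from (φ A) (φᴬ i)) centralᵤ centralᵥ
    where
    sᵤ≡sᵥ : s u ≡ s v [mod n ]
    sᵤ≡sᵥ = mod-≡⇒≡[mod] same-colour
    2x≡sᵤ : toℕ (φᴬ i) + toℕ (φᴬ i) ≡ s u [mod n ]
    2x≡sᵤ = shared-edge-fixed u∈i v∈i u≢v sᵤ≡sᵥ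

theorem2 : (n : ℕ) (H : Hypergraph n) → IsQuasicluster n H →
           Σ (EdgeArithmetic H) DifferentCentralEdges → χ≤ H n
theorem2 n H (_ , linear , _) (A , distinct) =
  reflectionColouring H linear A distinct , reflectionColouring-proper H linear A distinct
  where
  instance
    _ = Fin.nonZeroIndex (proj₁ (covered H (Fin.fromℕ< (nonempty H))))
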